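{- Let $\Phi=(A;\{E_i\}_{i=0}^d;A^*;\{E^*_i\}_{i=0}^d)$ be a tridiagonal system on $V$ with diameter $d\geq1$ that has $q$-Serre type. Then $V$ becomes a $U^+_q$-module on which $W_0$ acts as $A$ and $W_1$ acts as $A^*$, and this $U^+_q$-module is irreducible.
   Context: $\mathbb F$ is a field, $V$ a nonzero finite-dimensional $\mathbb F$-vector space. A TD pair on $V$ is an ordered pair $A,A^*\in\mathrm{End}(V)$ such that: each is diagonalizable; for some ordering $\{V_i\}_{i=0}^d$ of the eigenspaces of $A$, $A^*V_i\subseteq V_{i-1}+V_i+V_{i+1}$ ($V_{ -1}=V_{d+1}=0$); for some ordering $\{V^*_i\}_{i=0}^\delta$ of the eigenspaces of $A^*$, $AV^*_i\subseteq V^*_{i-1}+V^*_i+V^*_{i+1}$; and no subspace other than $0,V$ is invariant under both $A$ and $A^*$. Such orderings are standard. A TD system is $(A;\{E_i\}_{i=0}^d;A^*;\{E^*_i\}_{i=0}^\delta)$ with $A,A^*$ a TD pair and $\{E_i\}$, $\{E^*_i\}$ the primitive idempotents of $A$, $A^*$ in standard orderings; one has $d=\delta$. $\theta_i$ (resp. $\theta^*_i$) is the eigenvalue of $A$ for $E_i$ (resp. $A^*$ for $E^*_i$). Fix nonzero $q$ in the algebraic closure of $\mathbb F$, not a root of unity, with $b=q^2\in\mathbb F$. $\Phi$ has $q$-Serre type if $\theta_i=b\theta_{i-1}$ and $\theta^*_i=b^{ -1}\theta^*_{i-1}$ for $1\le i\le d$. $U^+_q$ is the $\mathbb F$-algebra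 with generators $W_0,W_1$ and relations $[W_0,[W_0,[W_0,W_1]_b]_{b^{ -1}}]=0$, $[W_1,[W_1,[W_1,W_0]_b]_{b^{ -1}}]=0$, where $[X,Y]=XY-YX$, $[X,Y]_b=bXY-YX$. -}

module Defs where

open import Level using (Level; _⊔_)
open import Algebra.Bundles using (CommutativeRing)
open import Data.Nat using (ℕ; zero; suc; _≤_)
import Data.Nat as ℕ
open import Data.Fin using (Fin; zero; suc; toℕ; inject₁)
open import Data.Product using (Σ; ∃; _×_; _,_)
open import Data.Sum using (_⊎_)
open import Relation.Nullary using (¬_)
open import Relation.Binary.PropositionalEquality using (_≡_; _≢_)

record Field (c ℓ : Level) : Set (Level.suc (c ⊔ ℓ)) where
  field
    commutativeRing : CommutativeRing c ℓ
  open CommutativeRing commutativeRing public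
  field
    1≉0     : ¬ (1# ≈ 0#)
    inverse : ∀ x → ¬ (x ≈ 0#) → Σ Carrier (λ y → x * y ≈ 1#)

-- Linear algebra on V = F^n (every nonzero finite-dimensional
-- F-vector space is isomorphic to some F^n), End(V) = n×n matrices.

module LinAlg {c ℓ : Level} (F : Field c ℓ) (n : ℕ) where
  open Field F using (Carrier; _≈_; _+_; _*_; -_; 0#; 1#)

  pow : Carrier → ℕ → Carrier
  pow x zero    = 1#
  pow x (suc m) = x * pow x m

  sumF : ∀ {m} → (Fin m → Carrier) → Carrier
  sumF {zero}  f = 0#
  sumF {suc m} f = f zero + sumF (λ i → f (suc i))

  Vect : Set c
  Vect = Fin n → Carrier

  Mat : Set c
  Mat = Fin n → Fin n → Carrier

  0v : Vect
  0v _ = 0#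

  _⊕v_ : Vect → Vect → Vect
  (u ⊕v v) i = u i + v i

  _•v_ : Carrier → Vect → Vect
  (a •v v) i = a * v i

  _≐_ : Vect → Vect → Set ℓ
  u ≐ v = ∀ i → u i ≈ v i

  O : Mat
  O _ _ = 0#

  idF : ∀ {m} → Fin m → Fin m → Carrier
  idF zero    zero    = 1#
  idF zero    (suc _) = 0#
  idF (suc _) zero    = 0#
  idF (suc i) (suc j) = idF i j

  I : Mat
  I = idF

  _⊕_ : Mat → Mat → Mat
  (M ⊕ N) i j = M i j + N i j

  _•_ : Carrier → Mat → Mat
  (a • M) i j = a * M i j

  _·_ : Mat → Mat → Mat
  (M · N) i j = sumF (λ k → M i k * N k j)

  _⊛_ : Mat → Vect → Vect
  (M ⊛ v) i = sumF (λ k → M i k * v k)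

  _≋_ : Mat → Mat → Set ℓ
  M ≋ N = ∀ i j → M i j ≈ N i j

  sumM : ∀ {m} → (Fin m → Mat) → Mat
  sumM {zero}  f = O
  sumM {suc m} f = f zero ⊕ sumM (λ i → f (suc i))

  record Subspace (W : Vect → Set (c ⊔ ℓ)) : Set (c ⊔ ℓ) where
    field
      resp  : ∀ {u v} → u ≐ v → W u → W v
      zero∈ : W 0v
      add∈  : ∀ {u v} → W u → W v → W (u ⊕v v)
      scale∈ : ∀ a {v} → W v → W (a •v v)

  Invariant : Mat → (Vect → Set (c ⊔ ℓ)) → Set (c ⊔ ℓ)
  Invariant M W = ∀ v → W v → W (M ⊛ v)

  Trivial : (Vect → Set (c ⊔ ℓ)) → Set (c ⊔ ℓ)
  Trivial W = (∀ v → W v → v ≐ 0v) ⊎ (∀ v → W v)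

  -- {E i} (i = 0..d) are the primitive idempotents of A, with E i
  -- associated to the eigenvalue θ i; this says exactly that A is
  -- diagonalizable with pairwise distinct eigenvalues θ 0 .. θ d and
  -- E i is the projection onto the θ i-eigenspace along the others.
  record PrimitiveIdempotents (d : ℕ) (A : Mat) (θ : Fin (suc d) → Carrier)
                              (E : Fin (suc d) → Mat) : Set (c ⊔ ℓ) where
    field
      distinct  : ∀ i j → θ i ≈ θ j → i ≡ j
      nonzero   : ∀ i → ¬ (E i ≋ O)
      idem      : ∀ i → (E i · E i) ≋ E i
      orth      : ∀ i j → i ≢ j → (E i · E j) ≋ O
      complete  : sumM E ≋ I
      spectral  : A ≋ sumM (λ i → θ i • E i)

  Far : ∀ {m} → Fin m → Fin m → Set
  Far i j = (2 ℕ.+ toℕ i ≤ toℕ j) ⊎ (2 ℕ.+ toℕ j ≤ toℕ i)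

  -- The tridiagonality conditions E i A* E j = 0 and E*_i A E*_j = 0
  -- for |i-j| > 1 are equivalent to A* V_j ⊆ V_{j-1}+V_j+V_{j+1} etc.
  record TDSystem (d : ℕ) : Set (Level.suc (c ⊔ ℓ)) where
    field
      A   : Mat
      θ   : Fin (suc d) → Carrier
      E   : Fin (suc d) → Mat
      A*  : Mat
      θ*  : Fin (suc d) → Carrier
      E*  : Fin (suc d) → Mat
      primA  : PrimitiveIdempotents d A θ E
      primA* : PrimitiveIdempotents d A* θ* E*
      tridiagA* : ∀ i j → Far i j → ((E i · A*) · E j) ≋ O
      tridiagA  : ∀ i j → Far i j → ((E* i · A) · E* j) ≋ O
      irreducible : ∀ W → Subspace W → Invariant A W → Invariant A* W
                    → Trivial W

  -- q-Serre type, with b = q² and b⁻¹ its inverse in F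
  QSerreType : ∀ {d} → TDSystem d → (b b⁻¹ : Carrier) → Set ℓ
  QSerreType {d} Φ b b⁻¹ =
    (∀ (i : Fin d) → θ (suc i) ≈ b * θ (inject₁ i)) ×
    (∀ (i : Fin d) → θ* (suc i) ≈ b⁻¹ * θ* (inject₁ i))
    where open TDSystem Φ

  -- U_q^+ : the free F-algebra on W₀, W₁ modulo the q-Serre relations.
  -- Elements of the free algebra are represented by terms.
  data UTerm : Set c where
    W₀ W₁ : UTerm
    sc    : Carrier → UTerm
    _+ᵤ_  : UTerm → UTerm → UTerm
    _*ᵤ_  : UTerm → UTerm → UTerm

  comm : UTerm → UTerm → UTerm
  comm X Y = (X *ᵤ Y) +ᵤ (sc (- 1#) *ᵤ (Y *ᵤ X))

  qcomm : Carrier → UTerm → UTerm → UTerm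
  qcomm a X Y = ((sc a *ᵤ X) *ᵤ Y) +ᵤ (sc (- 1#) *ᵤ (Y *ᵤ X))

  serre₀ serre₁ : (b b⁻¹ : Carrier) → UTerm
  serre₀ b b⁻¹ = comm W₀ (qcomm b⁻¹ W₀ (qcomm b W₀ W₁))

  serre₁ b b⁻¹ = comm W₁ (qcomm b⁻¹ W₁ (qcomm b W₁ W₀))

  eval : Mat → Mat → UTerm → Mat
  eval X Y W₀ = X
  eval X Y W₁ = Y
  eval X Y (sc a) = a • I
  eval X Y (s +ᵤ t) = eval X Y s ⊕ eval X Y t
  eval X Y (s *ᵤ t) = eval X Y s · eval X Y t

  -- V is a U_q^+-module with W₀ acting as X and W₁ as Y: the algebra
  -- map (free algebra → End V) determined by W₀ ↦ X, W₁ ↦ Y kills the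
  -- defining relators, hence factors through U_q^+.
  IsUqModule : (b b⁻¹ : Carrier) → Mat → Mat → Set ℓ
  IsUqModule b b⁻¹ X Y =
    (eval X Y (serre₀ b b⁻¹) ≋ O) × (eval X Y (serre₁ b b⁻¹) ≋ O)

  IrreducibleUqModule : Mat → Mat → Set (Level.suc (c ⊔ ℓ))
  IrreducibleUqModule X Y =
    (¬ (∀ (v : Vect) → v ≐ 0v)) ×
    (∀ W → Subspace W → (∀ t → Invariant (eval X Y t) W) → Trivial W)

-- Let P be A (resp. A*), Q the other one, and E_i the primitive idempotents of P.
-- Since E_i P = θ_i E_i and P E_j = θ_j E_j, the block E_i S E_j of the Serre expression
-- S = [P,[P,[P,Q]_b]_{b⁻¹}] is (θ_i - θ_j)(b⁻¹θ_i - θ_j)(bθ_i - θ_j) E_i Q E_j.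
-- It vanishes for |i - j| > 1 since Q is tridiagonal with respect to the E_i, for i = j by
-- the first factor, and for |i - j| = 1 because θ is geometric with ratio b (resp. b⁻¹).
-- So every block of S vanishes, hence S = 0. Irreducibility of V as a U_q^+-module is
-- irreducibility of the pair A, A*, since W₀ and W₁ act as A and A*.
module Submission where

open import Defs
open import Level using (Level)
open import Data.Nat using (ℕ; zero; suc; _≤_; z≤n; s≤s)
open import Data.Fin using (Fin; zero; suc; inject₁)
open import Data.Fin.Properties using (suc-injective)
open import Data.Product using (_×_; _,_; proj₁; proj₂)
open import Data.Sum using (_⊎_; inj₁; inj₂)
open import Function using (_∘_)
open import Relation.Nullary using (¬_)
open import Relation.Binary.Bundles using (Setoid)
open import Relation.Binary.PropositionalEquality as ≡ using (_≡_; _≢_)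
import Relation.Binary.Reasoning.Setoid as SetoidReasoning
import Algebra.Properties.Group as GroupProperties
import Algebra.Properties.Ring as RingProperties
import Algebra.Properties.Semiring.Sum as SemiringSum

module SerrePolynomial {c ℓ : Level} (F : Field c ℓ) where
  open Field F
  open GroupProperties +-group using (x≈y⇒x∙y⁻¹≈ε)

  serrePolynomial : Carrier → Carrier → Carrier → Carrier → Carrier
  serrePolynomial α β x y = (x - y) * ((β * x - y) * (α * x - y))

  serrePolynomial-diagonal : ∀ α β x → serrePolynomial α β x x ≈ 0#
  serrePolynomial-diagonal α β x = trans (*-congʳ (-‿inverseʳ x)) (zeroˡ _)

  serrePolynomial-by-β : ∀ α β {x y} → β * x ≈ y → serrePolynomial α β x y ≈ 0#
  serrePolynomial-by-β α β βx≈y =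
    trans (*-congˡ (trans (*-congʳ (x≈y⇒x∙y⁻¹≈ε βx≈y)) (zeroˡ _))) (zeroʳ _)

  serrePolynomial-by-α : ∀ α β {x y} → α * x ≈ y → serrePolynomial α β x y ≈ 0#
  serrePolynomial-by-α α β αx≈y =
    trans (*-congˡ (trans (*-congˡ (x≈y⇒x∙y⁻¹≈ε αx≈y)) (zeroʳ _))) (zeroʳ _)

  inverse-cancelˡ : ∀ {a b} → a * b ≈ 1# → ∀ z → a * (b * z) ≈ z
  inverse-cancelˡ ab≈1 z = trans (sym (*-assoc _ _ z)) (trans (*-congʳ ab≈1) (*-identityˡ z))

  serrePolynomial-adjacent : ∀ {α β x y} → α * β ≈ 1# → y ≈ α * x ⊎ y ≈ β * x →
    serrePolynomial α β x y ≈ 0# × serrePolynomial α β y x ≈ 0#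
  serrePolynomial-adjacent {α} {β} {x} αβ≈1 (inj₁ y≈αx) =
    serrePolynomial-by-α α β (sym y≈αx) ,
    serrePolynomial-by-β α β (trans (*-congˡ y≈αx) (inverse-cancelˡ (trans (*-comm β α) αβ≈1) x))
  serrePolynomial-adjacent {α} {β} {x} αβ≈1 (inj₂ y≈βx) =
    serrePolynomial-by-β α β (sym y≈βx) ,
    serrePolynomial-by-α α β (trans (*-congˡ y≈βx) (inverse-cancelˡ αβ≈1 x))

module MatrixAlgebra {c ℓ : Level} (F : Field c ℓ) (n : ℕ) where
  open Field F hiding (zero)
  open LinAlg F n
  open SerrePolynomial F
  open RingProperties ring using (-1*x≈-x)
  open SemiringSum semiring
    using (sum; sum-cong-≋; sum-replicate-zero; ∑-distrib-+; *-distribˡ-sum)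

  sumF≡sum : ∀ {m} (f : Fin m → Carrier) → sumF f ≡ sum f
  sumF≡sum {zero}  f = ≡.refl
  sumF≡sum {suc m} f = ≡.cong (f zero +_) (sumF≡sum (f ∘ suc))

  sumF-cong : ∀ {m} {f g : Fin m → Carrier} → (∀ k → f k ≈ g k) → sumF f ≈ sumF g
  sumF-cong {f = f} {g} f≈g rewrite sumF≡sum f | sumF≡sum g = sum-cong-≋ f≈g

  sumF-zero : ∀ {m} {f : Fin m → Carrier} → (∀ k → f k ≈ 0#) → sumF f ≈ 0#
  sumF-zero {m} f≈0 = trans (sumF-cong f≈0) (trans (reflexive (sumF≡sum {m} (λ _ → 0#))) (sum-replicate-zero m))

  sumF-distrib-+ : ∀ {m} (f g : Fin m → Carrier) → sumF (λ k → f k + g k) ≈ sumF f + sumF g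
  sumF-distrib-+ f g
    rewrite sumF≡sum (λ k → f k + g k) | sumF≡sum f | sumF≡sum g = ∑-distrib-+ f g

  sumF-distribˡ-* : ∀ {m} a (f : Fin m → Carrier) → sumF (λ k → a * f k) ≈ a * sumF f
  sumF-distribˡ-* a f
    rewrite sumF≡sum (λ k → a * f k) | sumF≡sum f = sym (*-distribˡ-sum a f)

  sumF-distribʳ-* : ∀ {m} a (f : Fin m → Carrier) → sumF (λ k → f k * a) ≈ sumF f * a
  sumF-distribʳ-* a f =
    trans (sumF-cong (λ k → *-comm (f k) a)) (trans (sumF-distribˡ-* a f) (*-comm a _))

  sumF-comm : ∀ {m p} (f : Fin m → Fin p → Carrier) →
    sumF (λ k → sumF (λ l → f k l)) ≈ sumF (λ l → sumF (λ k → f k l))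
  sumF-comm {zero} {p} f = sym (sumF-zero {p} (λ _ → refl))
  sumF-comm {suc m} {p} f =
    trans (+-congˡ (sumF-comm (f ∘ suc))) (sym (sumF-distrib-+ {p} (f zero) _))

  sumF-idˡ : ∀ {m} (i : Fin m) (f : Fin m → Carrier) → sumF (λ k → idF i k * f k) ≈ f i
  sumF-idˡ {suc m} zero    f = trans (+-cong (*-identityˡ _) (sumF-zero {m} (λ _ → zeroˡ _))) (+-identityʳ _)
  sumF-idˡ {suc m} (suc i) f = trans (+-cong (zeroˡ _) (sumF-idˡ i (f ∘ suc))) (+-identityˡ _)

  sumF-idʳ : ∀ {m} (j : Fin m) (f : Fin m → Carrier) → sumF (λ k → f k * idF k j) ≈ f j
  sumF-idʳ {suc m} zero    f = trans (+-cong (*-identityʳ _) (sumF-zero {m} (λ _ → zeroʳ _))) (+-identityʳ _)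
  sumF-idʳ {suc m} (suc j) f = trans (+-cong (zeroʳ _) (sumF-idʳ j (f ∘ suc))) (+-identityˡ _)

  ≋-refl : ∀ {M} → M ≋ M
  ≋-refl i j = refl

  ≋-sym : ∀ {M N} → M ≋ N → N ≋ M
  ≋-sym M≋N i j = sym (M≋N i j)

  ≋-trans : ∀ {M N P} → M ≋ N → N ≋ P → M ≋ P
  ≋-trans M≋N N≋P i j = trans (M≋N i j) (N≋P i j)

  ≋-setoid : Setoid c ℓ
  ≋-setoid = record
    { Carrier       = Mat
    ; _≈_           = _≋_
    ; isEquivalence = record
      { refl  = λ {M} → ≋-refl {M}
      ; sym   = λ {M} {N} → ≋-sym {M} {N}
      ; trans = λ {M} {N} {P} → ≋-trans {M} {N} {P}
      }
    }

  ·-cong : ∀ {M M′ N N′} → M ≋ M′ → N ≋ N′ → (M · N) ≋ (M′ · N′)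
  ·-cong M≋M′ N≋N′ i j = sumF-cong {n} (λ k → *-cong (M≋M′ i k) (N≋N′ k j))

  ⊕-cong : ∀ {M M′ N N′} → M ≋ M′ → N ≋ N′ → (M ⊕ N) ≋ (M′ ⊕ N′)
  ⊕-cong M≋M′ N≋N′ i j = +-cong (M≋M′ i j) (N≋N′ i j)

  •-cong : ∀ {a b M N} → a ≈ b → M ≋ N → (a • M) ≋ (b • N)
  •-cong a≈b M≋N i j = *-cong a≈b (M≋N i j)

  ·-assoc : ∀ M N P → ((M · N) · P) ≋ (M · (N · P))
  ·-assoc M N P i j = begin
    sumF (λ k → sumF (λ l → M i l * N l k) * P k j)
      ≈⟨ sumF-cong {n} (λ k → sym (sumF-distribʳ-* (P k j) (λ l → M i l * N l k))) ⟩
    sumF (λ k → sumF (λ l → (M i l * N l k) * P k j))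
      ≈⟨ sumF-comm (λ k l → (M i l * N l k) * P k j) ⟩
    sumF (λ l → sumF (λ k → (M i l * N l k) * P k j))
      ≈⟨ sumF-cong {n} (λ l → sumF-cong {n} (λ k → *-assoc (M i l) (N l k) (P k j))) ⟩
    sumF (λ l → sumF (λ k → M i l * (N l k * P k j)))
      ≈⟨ sumF-cong {n} (λ l → sumF-distribˡ-* (M i l) (λ k → N l k * P k j)) ⟩
    sumF (λ l → M i l * sumF (λ k → N l k * P k j))
      ∎
    where open SetoidReasoning setoid

  ·-distribˡ-⊕ : ∀ M N P → (M · (N ⊕ P)) ≋ ((M · N) ⊕ (M · P))
  ·-distribˡ-⊕ M N P i j = trans (sumF-cong {n} (λ k → distribˡ _ _ _)) (sumF-distrib-+ {n} _ _)

  ·-distribʳ-⊕ : ∀ M N P → ((N ⊕ P) · M) ≋ ((N · M) ⊕ (P · M))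
  ·-distribʳ-⊕ M N P i j = trans (sumF-cong {n} (λ k → distribʳ _ _ _)) (sumF-distrib-+ {n} _ _)

  •-·-assoc : ∀ a M N → ((a • M) · N) ≋ (a • (M · N))
  •-·-assoc a M N i j = trans (sumF-cong {n} (λ k → *-assoc _ _ _)) (sumF-distribˡ-* {n} a _)

  ·-•-comm : ∀ a M N → (M · (a • N)) ≋ (a • (M · N))
  ·-•-comm a M N i j =
    trans (sumF-cong {n} (λ k → trans (sym (*-assoc _ _ _)) (trans (*-congʳ (*-comm _ _)) (*-assoc _ _ _)))) (sumF-distribˡ-* {n} a _)

  ·-identityˡ : ∀ M → (I · M) ≋ M
  ·-identityˡ M i j = sumF-idˡ i (λ k → M k j)

  ·-identityʳ : ∀ M → (M · I) ≋ M
  ·-identityʳ M i j = sumF-idʳ j (λ k → M i k)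

  ·-zeroˡ : ∀ M → (O · M) ≋ O
  ·-zeroˡ M i j = sumF-zero {n} (λ k → zeroˡ _)

  ·-zeroʳ : ∀ M → (M · O) ≋ O
  ·-zeroʳ M i j = sumF-zero {n} (λ k → zeroʳ _)

  •-zeroˡ : ∀ {a} M → a ≈ 0# → (a • M) ≋ O
  •-zeroˡ M a≈0 i j = trans (*-congʳ a≈0) (zeroˡ _)

  •-zeroʳ : ∀ a → (a • O) ≋ O
  •-zeroʳ a i j = zeroʳ a

  •-assoc : ∀ a b M → (a • (b • M)) ≋ ((a * b) • M)
  •-assoc a b M i j = sym (*-assoc _ _ _)

  •-distrib-+ : ∀ a b M → ((a • M) ⊕ (b • M)) ≋ ((a + b) • M)
  •-distrib-+ a b M i j = sym (distribʳ _ _ _)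

  scalar-· : ∀ a M → ((a • I) · M) ≋ (a • M)
  scalar-· a M = ≋-trans (•-·-assoc a I M) (•-cong refl (·-identityˡ M))

  -1•a•M≋-a•M : ∀ a M → ((- 1#) • (a • M)) ≋ ((- a) • M)
  -1•a•M≋-a•M a M = ≋-trans (•-assoc _ a M) (•-cong (-1*x≈-x a) ≋-refl)

  sumM-cong : ∀ {m} {f g : Fin m → Mat} → (∀ i → f i ≋ g i) → sumM f ≋ sumM g
  sumM-cong {zero}  f≋g = ≋-refl
  sumM-cong {suc m} f≋g = ⊕-cong (f≋g zero) (sumM-cong (f≋g ∘ suc))

  sumM-zero : ∀ {m} {f : Fin m → Mat} → (∀ i → f i ≋ O) → sumM f ≋ O
  sumM-zero {zero}  f≋O = ≋-refl
  sumM-zero {suc m} f≋O i j = trans (+-cong (f≋O zero i j) (sumM-zero (f≋O ∘ suc) i j)) (+-identityˡ 0#)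

  sumM-single : ∀ {m} (f : Fin m → Mat) (i : Fin m) → (∀ k → k ≢ i → f k ≋ O) → sumM f ≋ f i
  sumM-single f zero    others≋O x y =
    trans (+-congˡ (sumM-zero (λ k → others≋O (suc k) (λ ())) x y)) (+-identityʳ _)
  sumM-single f (suc i) others≋O x y =
    trans (+-cong (others≋O zero (λ ()) x y)
                  (sumM-single (f ∘ suc) i (λ k k≢i → others≋O (suc k) (k≢i ∘ suc-injective)) x y))
          (+-identityˡ _)

  sumM-distribʳ-· : ∀ {m} (f : Fin m → Mat) M → (sumM f · M) ≋ sumM (λ i → f i · M)
  sumM-distribʳ-· {zero}  f M = ·-zeroˡ M
  sumM-distribʳ-· {suc m} f M = ≋-trans (·-distribʳ-⊕ M _ _) (⊕-cong ≋-refl (sumM-distribʳ-· (f ∘ suc) M))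

  sumM-distribˡ-· : ∀ {m} (f : Fin m → Mat) M → (M · sumM f) ≋ sumM (λ i → M · f i)
  sumM-distribˡ-· {zero}  f M = ·-zeroʳ M
  sumM-distribˡ-· {suc m} f M = ≋-trans (·-distribˡ-⊕ M _ _) (⊕-cong ≋-refl (sumM-distribˡ-· (f ∘ suc) M))

  data Position {d : ℕ} : Fin (suc d) → Fin (suc d) → Set where
    far      : ∀ {i j} → Far i j → Position i j
    diagonal : ∀ {i} → Position i i
    above    : ∀ k → Position (inject₁ k) (suc k)
    below    : ∀ k → Position (suc k) (inject₁ k)

  position : ∀ {d} (i j : Fin (suc d)) → Position i j
  position zero zero = diagonal
  position {suc d} zero          (suc zero)    = above zero
  position {suc d} zero          (suc (suc j)) = far (inj₁ (s≤s (s≤s z≤n)))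
  position {suc d} (suc zero)    zero          = below zero
  position {suc d} (suc (suc i)) zero          = far (inj₂ (s≤s (s≤s z≤n)))
  position {suc d} (suc i)       (suc j)       with position i j
  ... | far (inj₁ i+2≤j) = far (inj₁ (s≤s i+2≤j))
  ... | far (inj₂ j+2≤i) = far (inj₂ (s≤s j+2≤i))
  ... | diagonal         = diagonal
  ... | above k          = above (suc k)
  ... | below k          = below (suc k)

  module Blocks {d : ℕ} {P : Mat} {θ : Fin (suc d) → Carrier} {E : Fin (suc d) → Mat}
                (P-idempotents : PrimitiveIdempotents d P θ E) where
    open PrimitiveIdempotents P-idempotents
    open SetoidReasoning ≋-setoid

    E·P≋θ•E : ∀ i → (E i · P) ≋ (θ i • E i)
    E·P≋θ•E i = begin
      E i · P
        ≈⟨ ·-cong ≋-refl spectral ⟩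
      E i · sumM (λ k → θ k • E k)
        ≈⟨ sumM-distribˡ-· (λ k → θ k • E k) (E i) ⟩
      sumM (λ k → E i · (θ k • E k))
        ≈⟨ sumM-cong (λ k → ·-•-comm (θ k) (E i) (E k)) ⟩
      sumM (λ k → θ k • (E i · E k))
        ≈⟨ sumM-single (λ k → θ k • (E i · E k)) i
             (λ k k≢i → ≋-trans (•-cong refl (orth i k (k≢i ∘ ≡.sym))) (•-zeroʳ _)) ⟩
      θ i • (E i · E i)
        ≈⟨ •-cong refl (idem i) ⟩
      θ i • E i
        ∎

    P·E≋θ•E : ∀ j → (P · E j) ≋ (θ j • E j)
    P·E≋θ•E j = begin
      P · E j
        ≈⟨ ·-cong spectral ≋-refl ⟩
      sumM (λ k → θ k • E k) · E j
        ≈⟨ sumM-distribʳ-· (λ k → θ k • E k) (E j) ⟩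
      sumM (λ k → (θ k • E k) · E j)
        ≈⟨ sumM-cong (λ k → •-·-assoc (θ k) (E k) (E j)) ⟩
      sumM (λ k → θ k • (E k · E j))
        ≈⟨ sumM-single (λ k → θ k • (E k · E j)) j
             (λ k k≢j → ≋-trans (•-cong refl (orth k j k≢j)) (•-zeroʳ _)) ⟩
      θ j • (E j · E j)
        ≈⟨ •-cong refl (idem j) ⟩
      θ j • E j
        ∎

    block : Fin (suc d) → Fin (suc d) → Mat → Mat
    block i j X = (E i · X) · E j

    block-cong : ∀ i j {X Y} → X ≋ Y → block i j X ≋ block i j Y
    block-cong i j X≋Y = ·-cong (·-cong ≋-refl X≋Y) ≋-refl

    block-⊕ : ∀ i j X Y → block i j (X ⊕ Y) ≋ (block i j X ⊕ block i j Y)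
    block-⊕ i j X Y = ≋-trans (·-cong (·-distribˡ-⊕ (E i) X Y) ≋-refl) (·-distribʳ-⊕ (E j) _ _)

    block-scalar-· : ∀ i j a X → block i j ((a • I) · X) ≋ (a • block i j X)
    block-scalar-· i j a X = begin
      (E i · ((a • I) · X)) · E j  ≈⟨ ·-cong (·-cong ≋-refl (scalar-· a X)) ≋-refl ⟩
      (E i · (a • X)) · E j        ≈⟨ ·-cong (·-•-comm a (E i) X) ≋-refl ⟩
      (a • (E i · X)) · E j        ≈⟨ •-·-assoc a _ _ ⟩
      a • block i j X              ∎

    block-P· : ∀ i j X → block i j (P · X) ≋ (θ i • block i j X)
    block-P· i j X = begin
      (E i · (P · X)) · E j    ≈⟨ ·-cong (≋-sym (·-assoc (E i) P X)) ≋-refl ⟩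
      ((E i · P) · X) · E j    ≈⟨ ·-cong (·-cong (E·P≋θ•E i) ≋-refl) ≋-refl ⟩
      ((θ i • E i) · X) · E j  ≈⟨ ·-cong (•-·-assoc (θ i) (E i) X) ≋-refl ⟩
      (θ i • (E i · X)) · E j  ≈⟨ •-·-assoc (θ i) _ _ ⟩
      θ i • block i j X        ∎

    block-·P : ∀ i j X → block i j (X · P) ≋ (θ j • block i j X)
    block-·P i j X = begin
      (E i · (X · P)) · E j   ≈⟨ ·-cong (≋-sym (·-assoc (E i) X P)) ≋-refl ⟩
      ((E i · X) · P) · E j   ≈⟨ ·-assoc _ P (E j) ⟩
      (E i · X) · (P · E j)   ≈⟨ ·-cong ≋-refl (P·E≋θ•E j) ⟩
      (E i · X) · (θ j • E j) ≈⟨ ·-•-comm (θ j) _ _ ⟩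
      θ j • block i j X       ∎

    blocks≋O⇒≋O : ∀ X → (∀ i j → block i j X ≋ O) → X ≋ O
    blocks≋O⇒≋O X blocks≋O = begin
      X                         ≈⟨ ≋-sym (·-identityˡ X) ⟩
      I · X                     ≈⟨ ·-cong (≋-sym complete) ≋-refl ⟩
      sumM E · X                ≈⟨ sumM-distribʳ-· E X ⟩
      sumM (λ i → E i · X)      ≈⟨ sumM-zero row≋O ⟩
      O                         ∎
      where
      row≋O : ∀ i → (E i · X) ≋ O
      row≋O i = begin
        E i · X                   ≈⟨ ≋-sym (·-identityʳ _) ⟩
        (E i · X) · I             ≈⟨ ·-cong ≋-refl (≋-sym complete) ⟩
        (E i · X) · sumM E        ≈⟨ sumM-distribˡ-· E _ ⟩
        sumM (λ j → block i j X)  ≈⟨ sumM-zero (blocks≋O i) ⟩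
        O                         ∎

    block-negated-·P : ∀ i j Y → block i j (((- 1#) • I) · (Y · P)) ≋ ((- θ j) • block i j Y)
    block-negated-·P i j Y = begin
      block i j (((- 1#) • I) · (Y · P))  ≈⟨ block-scalar-· i j (- 1#) _ ⟩
      (- 1#) • block i j (Y · P)          ≈⟨ •-cong refl (block-·P i j Y) ⟩
      (- 1#) • (θ j • block i j Y)        ≈⟨ -1•a•M≋-a•M (θ j) _ ⟩
      (- θ j) • block i j Y               ∎

    block-comm : ∀ Q i j t →
      block i j (eval P Q (comm W₀ t)) ≋ ((θ i - θ j) • block i j (eval P Q t))
    block-comm Q i j t = begin
      block i j (eval P Q (comm W₀ t))
        ≈⟨ block-⊕ i j _ _ ⟩
      block i j (P · Y) ⊕ block i j (((- 1#) • I) · (Y · P))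
        ≈⟨ ⊕-cong (block-P· i j Y) (block-negated-·P i j Y) ⟩
      (θ i • block i j Y) ⊕ ((- θ j) • block i j Y)
        ≈⟨ •-distrib-+ (θ i) (- θ j) _ ⟩
      (θ i - θ j) • block i j Y
        ∎
      where Y = eval P Q t

    block-qcomm : ∀ Q a i j t →
      block i j (eval P Q (qcomm a W₀ t)) ≋ ((a * θ i - θ j) • block i j (eval P Q t))
    block-qcomm Q a i j t = begin
      block i j (eval P Q (qcomm a W₀ t))
        ≈⟨ block-⊕ i j _ _ ⟩
      block i j (((a • I) · P) · Y) ⊕ block i j (((- 1#) • I) · (Y · P))
        ≈⟨ ⊕-cong (block-cong i j (·-assoc _ P Y)) (block-negated-·P i j Y) ⟩
      block i j ((a • I) · (P · Y)) ⊕ ((- θ j) • block i j Y)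
        ≈⟨ ⊕-cong (block-scalar-· i j a _) ≋-refl ⟩
      (a • block i j (P · Y)) ⊕ ((- θ j) • block i j Y)
        ≈⟨ ⊕-cong (≋-trans (•-cong refl (block-P· i j Y)) (•-assoc a (θ i) _)) ≋-refl ⟩
      ((a * θ i) • block i j Y) ⊕ ((- θ j) • block i j Y)
        ≈⟨ •-distrib-+ (a * θ i) (- θ j) _ ⟩
      (a * θ i - θ j) • block i j Y
        ∎
      where Y = eval P Q t

    block-serre : ∀ α β Q i j →
      block i j (eval P Q (serre₀ α β)) ≋ (serrePolynomial α β (θ i) (θ j) • block i j Q)
    block-serre α β Q i j = begin
      block i j (eval P Q (serre₀ α β))
        ≈⟨ block-comm Q i j (qcomm β W₀ (qcomm α W₀ W₁)) ⟩
      (θ i - θ j) • block i j (eval P Q (qcomm β W₀ (qcomm α W₀ W₁)))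
        ≈⟨ •-cong refl (block-qcomm Q β i j (qcomm α W₀ W₁)) ⟩
      (θ i - θ j) • ((β * θ i - θ j) • block i j (eval P Q (qcomm α W₀ W₁)))
        ≈⟨ •-cong refl (•-cong refl (block-qcomm Q α i j W₁)) ⟩
      (θ i - θ j) • ((β * θ i - θ j) • ((α * θ i - θ j) • block i j Q))
        ≈⟨ ≋-trans (•-cong refl (•-assoc _ _ _)) (•-assoc _ _ _) ⟩
      serrePolynomial α β (θ i) (θ j) • block i j Q
        ∎

    serre-relation : ∀ α β Q → (∀ i j → Far i j → block i j Q ≋ O) →
      (∀ k → serrePolynomial α β (θ (inject₁ k)) (θ (suc k)) ≈ 0#
           × serrePolynomial α β (θ (suc k)) (θ (inject₁ k)) ≈ 0#) →
      eval P Q (serre₀ α β) ≋ O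
    serre-relation α β Q Q-tridiagonal adjacent≈0 =
      blocks≋O⇒≋O _ (λ i j → block≋O (position i j))
      where
      polynomial≈0⇒block≋O : ∀ {i j} → serrePolynomial α β (θ i) (θ j) ≈ 0# →
        block i j (eval P Q (serre₀ α β)) ≋ O
      polynomial≈0⇒block≋O {i} {j} p≈0 = ≋-trans (block-serre α β Q i j) (•-zeroˡ _ p≈0)

      block≋O : ∀ {i j} → Position i j → block i j (eval P Q (serre₀ α β)) ≋ O
      block≋O {i} {j} (far i-far-j) =
        ≋-trans (block-serre α β Q i j) (≋-trans (•-cong refl (Q-tridiagonal i j i-far-j)) (•-zeroʳ _))
      block≋O {i} diagonal = polynomial≈0⇒block≋O (serrePolynomial-diagonal α β (θ i))
      block≋O (above k)    = polynomial≈0⇒block≋O (proj₁ (adjacent≈0 k))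
      block≋O (below k)    = polynomial≈0⇒block≋O (proj₂ (adjacent≈0 k))

corollary9p3 : ∀ {c ℓ : Level} (F : Field c ℓ) (n : ℕ) → 1 ≤ n →
    let open Field F in let open LinAlg F n in
    (b b⁻¹ : Carrier) → b * b⁻¹ ≈ 1# →
    (∀ (m : ℕ) → ¬ (pow b (suc m) ≈ 1#)) →
    (d : ℕ) → 1 ≤ d → (Φ : TDSystem d) → QSerreType Φ b b⁻¹ →
    IsUqModule b b⁻¹ (TDSystem.A Φ) (TDSystem.A* Φ) ×
    IrreducibleUqModule (TDSystem.A Φ) (TDSystem.A* Φ)
corollary9p3 F (suc n) _ b b⁻¹ bb⁻¹≈1 _ d _ Φ (θ-geometric , θ*-geometric) =
  (serre₀-holds , serre₁-holds) , (V≢0 , irreducible-under-A-and-A*)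
  where
  open Field F hiding (zero)
  open LinAlg F (suc n)
  open MatrixAlgebra F (suc n)
  open SerrePolynomial F
  open TDSystem Φ

  serre₀-holds : eval A A* (serre₀ b b⁻¹) ≋ O
  serre₀-holds = Blocks.serre-relation primA b b⁻¹ A* tridiagA*
    (λ k → serrePolynomial-adjacent bb⁻¹≈1 (inj₁ (θ-geometric k)))

  -- serre₁ evaluated at (A, A*) is serre₀ evaluated at (A*, A).
  serre₁-holds : eval A A* (serre₁ b b⁻¹) ≋ O
  serre₁-holds = Blocks.serre-relation primA* b b⁻¹ A tridiagA
    (λ k → serrePolynomial-adjacent bb⁻¹≈1 (inj₂ (θ*-geometric k)))

  V≢0 : ¬ (∀ (v : Vect) → v ≐ 0v)
  V≢0 V≐0 = 1≉0 (V≐0 (λ _ → 1#) zero)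

  irreducible-under-A-and-A* : ∀ W → Subspace W → (∀ t → Invariant (eval A A* t) W) → Trivial W
  irreducible-under-A-and-A* W W-subspace W-invariant =
    irreducible W W-subspace (W-invariant W₀) (W-invariant W₁)
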